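{- Let $G$ be a connected graph of order $n\geq 2$ and $p$ a positive integer. Then $$\gamma_t(M(G+\overline{K_p}))= \begin{cases} p & \text{if } p\geq 2n,\\ \left\lceil\frac{2(n+p)}{3}\right\rceil & \text{if } \frac{n}{2}\le p\le 2n-1. \end{cases}$$
   Context: All graphs are finite and simple. $\overline{K_p}$ denotes the edgeless graph on $p$ vertices. The join $G+H$ of graphs $G,H$ (on disjoint vertex sets) has vertex set $V(G)\cup V(H)$ and edge set $E(G)\cup E(H)\cup\{vw : v\in V(G), w\in V(H)\}$. For a graph $H$ with no isolated vertices, a total dominating set of $H$ is a set $S\subseteq V(H)$ such that every vertex of $H$ has at least one neighbor in $S$; $\gamma_t(H)$ is the minimum cardinality of a total dominating set. The middle graph $M(G)$ of a graph $G$ has vertex set $V(G)\cup E(G)$ (disjoint union), and two of its vertices $x,y$ are adjacent exactly when either $x,y\in E(G)$ are edges of $G$ sharing a common endpoint, or $x\in V(G)$, $y\in E(G)$ and $x$ is an endpoint of $y$ (no two elements of $V(G)$ are adjacent in $M(G)$). -}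

module Defs where

open import Data.Nat using (ℕ; _≤_)
open import Data.Nat as ℕ using ()
open import Data.Fin using (Fin; splitAt; _<_)
open import Data.Bool using (Bool; true; false; T)
open import Data.Sum using (_⊎_; inj₁; inj₂)
open import Data.Product using (Σ; _×_; _,_; proj₁; proj₂)
open import Data.Empty using (⊥)
open import Data.List using (List; length)
open import Data.List.Relation.Unary.Any using (Any)
open import Data.List.Relation.Unary.Unique.Propositional using (Unique)
open import Relation.Binary.PropositionalEquality using (_≡_; _≢_; refl; sym)
open import Relation.Nullary using (¬_)

record SimpleGraph (n : ℕ) : Set where
  field
    adj    : Fin n → Fin n → Bool
    adj-sym : ∀ u v → adj u v ≡ adj v u
    adj-irr : ∀ v → adj v v ≡ false
open SimpleGraph public

data Reachable {n : ℕ} (G : SimpleGraph n) : Fin n → Fin n → Set where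
  here : ∀ {u} → Reachable G u u
  step : ∀ {u w v} → adj G u w ≡ true → Reachable G w v → Reachable G u v

Connected : ∀ {n} → SimpleGraph n → Set
Connected G = ∀ u v → Reachable G u v

-- Join G + (edgeless graph on p vertices); vertices of G are the first n
-- elements of Fin (n + p), those of the edgeless graph the last p.
joinAdj : ∀ {n p} → (Fin n → Fin n → Bool) → Fin n ⊎ Fin p → Fin n ⊎ Fin p → Bool
joinAdj a (inj₁ x) (inj₁ y) = a x y
joinAdj a (inj₁ x) (inj₂ y) = true
joinAdj a (inj₂ x) (inj₁ y) = true
joinAdj a (inj₂ x) (inj₂ y) = false

joinAdj-sym : ∀ {n p} (G : SimpleGraph n) (x y : Fin n ⊎ Fin p) →
              joinAdj (adj G) x y ≡ joinAdj (adj G) y x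
joinAdj-sym G (inj₁ x) (inj₁ y) = adj-sym G x y
joinAdj-sym G (inj₁ x) (inj₂ y) = refl
joinAdj-sym G (inj₂ x) (inj₁ y) = refl
joinAdj-sym G (inj₂ x) (inj₂ y) = refl

joinAdj-irr : ∀ {n p} (G : SimpleGraph n) (x : Fin n ⊎ Fin p) →
              joinAdj (adj G) x x ≡ false
joinAdj-irr G (inj₁ x) = adj-irr G x
joinAdj-irr G (inj₂ x) = refl

joinEmpty : ∀ {n} → SimpleGraph n → (p : ℕ) → SimpleGraph (n ℕ.+ p)
joinEmpty {n} G p = record
  { adj    = λ i j → joinAdj (adj G) (splitAt n i) (splitAt n j)
  ; adj-sym = λ i j → joinAdj-sym G (splitAt n i) (splitAt n j)
  ; adj-irr = λ i → joinAdj-irr G (splitAt n i)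
  }

Edge : ∀ {m} → SimpleGraph m → Set
Edge {m} G = Σ (Fin m × Fin m) λ e → (proj₁ e < proj₂ e) × T (adj G (proj₁ e) (proj₂ e))

Incident : ∀ {m} {G : SimpleGraph m} → Fin m → Edge G → Set
Incident v ((a , b) , _) = (v ≡ a) ⊎ (v ≡ b)

record Graph : Set₁ where
  field
    V       : Set
    Adj     : V → V → Set
    Adj-sym : ∀ {u v} → Adj u v → Adj v u
    Adj-irr : ∀ {v} → ¬ Adj v v
open Graph public

MAdj : ∀ {m} (G : SimpleGraph m) → Fin m ⊎ Edge G → Fin m ⊎ Edge G → Set
MAdj G (inj₁ v) (inj₁ w) = ⊥
MAdj G (inj₁ v) (inj₂ e) = Incident {G = G} v e
MAdj G (inj₂ e) (inj₁ v) = Incident {G = G} v e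
MAdj G (inj₂ e) (inj₂ f) = (e ≢ f) × Σ _ λ v → Incident {G = G} v e × Incident {G = G} v f

MAdj-sym : ∀ {m} (G : SimpleGraph m) {x y} → MAdj G x y → MAdj G y x
MAdj-sym G {inj₁ v} {inj₂ e} h = h
MAdj-sym G {inj₂ e} {inj₁ v} h = h
MAdj-sym G {inj₂ e} {inj₂ f} (ne , v , i , j) = (λ eq → ne (sym eq)) , v , j , i

MAdj-irr : ∀ {m} (G : SimpleGraph m) {x} → ¬ MAdj G x x
MAdj-irr G {inj₁ v} ()
MAdj-irr G {inj₂ e} (ne , _) = ne refl

Middle : ∀ {m} → SimpleGraph m → Graph
Middle G = record
  { V = Fin _ ⊎ Edge G ; Adj = MAdj G
  ; Adj-sym = λ {x} {y} → MAdj-sym G {x} {y}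
  ; Adj-irr = λ {x} → MAdj-irr G {x} }

IsTDS : (H : Graph) → List (V H) → Set
IsTDS H S = ∀ v → Any (λ s → Adj H v s) S

TotalDomNum : (H : Graph) → ℕ → Set
TotalDomNum H k =
  (Σ (List (V H)) λ S → Unique S × IsTDS H S × length S ≡ k) ×
  (∀ S → Unique S → IsTDS H S → k ≤ length S)

{-# OPTIONS --safe #-}
module Submission where

-- Lower bounds hold for any graph H of order m and any total dominating set S of M(H). Every vertex v
-- is dominated by an edge chosen(v) ∈ S, and the vertices of an independent set choose distinct edges.
-- Moreover two copies of each vertex inject into the 3|S| slots S × {0,1,2}: the first copy of v takes
-- the slot of its side in chosen(v), the second takes slot 2 of chosen(v), unless both endpoints chose
-- that edge, in which case the upper endpoint is charged to the dominator of the edge itself.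
--
-- Upper bounds use only edges between G and the edgeless part: a spanning forest of stars with at
-- least two edges each totally dominates M(G + K̄_p). With n stars K_{1,2} centred in G plus
-- p − 2n leaves this has p edges; with ⌊(n+p)/3⌋ stars K_{1,2} plus at most two leaves it has
-- ⌈2(n+p)/3⌉ edges.

open import Defs
open import Data.Nat as ℕ using (ℕ; zero; suc; _+_; _*_; _≤_; _<_; z≤n; s≤s)
open import Data.Nat.Properties as ℕₚ using ()
open import Data.Nat.DivMod using (_/_; _divMod_; result; /-congˡ; +-distrib-/-∣ʳ; m*n/n≡m; m<n*o⇒m/o<n)
open import Data.Nat.Divisibility using (divides-refl)
open import Data.Fin as Fin using (Fin; zero; suc; splitAt; join; combine; _↑ˡ_; _↑ʳ_; toℕ)
open import Data.Fin.Properties as Finₚ using (_≟_; injective⇒≤; combine-injective; join-splitAt; <-irrelevant)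
open import Data.Sum as Sum using (_⊎_; inj₁; inj₂)
open import Data.Sum.Properties using (inj₂-injective)
open import Data.Product as Product using (Σ; ∃; _×_; _,_; proj₁; proj₂; uncurry; swap)
open import Data.Product.Properties using (≡-dec)
open import Data.Empty using (⊥-elim)
open import Data.Bool using (T)
open import Data.Bool.Properties using (T-irrelevant)
open import Data.List using (List; []; _∷_; length; lookup; map)
open import Data.List.Properties using (length-map)
open import Data.List.Relation.Unary.Any as Any using (Any; here; there; index)
import Data.List.Relation.Unary.Any.Properties as Anyₚ
open import Data.List.Relation.Unary.Any.Properties using (lookup-index)
import Data.List.Relation.Unary.All as All
import Data.List.Relation.Unary.All.Properties as Allₚ
open import Data.List.Relation.Unary.AllPairs using ([]; _∷_)
open import Data.List.Relation.Unary.Unique.Propositional using (Unique)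
import Data.List.Relation.Unary.Unique.Propositional.Properties as Uniqueₚ
open import Function using (_∘_)
open import Function.Definitions using (Injective)
open import Relation.Binary.Definitions using (DecidableEquality)
open import Relation.Binary.PropositionalEquality
open import Relation.Nullary using (¬_; yes; no)
open import Relation.Nullary.Decidable using (map′)
open import Data.Nat.Tactic.RingSolver using (solve-∀)

⊎-to-×-injective⇒≤ : ∀ {a b c d} (g : Fin a ⊎ Fin b → Fin c × Fin d) →
                     Injective _≡_ _≡_ g → a + b ≤ c * d
⊎-to-×-injective⇒≤ {a} {b} g g-inj = injective⇒≤ {f = uncurry combine ∘ g ∘ splitAt a} injective
  where
  injective : Injective _≡_ _≡_ (uncurry combine ∘ g ∘ splitAt a)
  injective {i} {j} eq = begin
    i                        ≡⟨ join-splitAt a b i ⟨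
    join a b (splitAt a i)   ≡⟨ cong (join a b) (g-inj (uncurry (cong₂ _,_) (combine-injective _ _ _ _ eq))) ⟩
    join a b (splitAt a j)   ≡⟨ join-splitAt a b j ⟩
    j                        ∎
    where open ≡-Reasoning

module MiddleGraphBounds {m : ℕ} (H : SimpleGraph m) where

  _∈ᵉ_ : Fin m → Edge H → Set
  v ∈ᵉ e = Incident {G = H} v e

  lo hi : Edge H → Fin m
  lo e = proj₁ (proj₁ e)
  hi e = proj₂ (proj₁ e)

  Edge-≡ : {e e' : Edge H} → proj₁ e ≡ proj₁ e' → e ≡ e'
  Edge-≡ {ab , l , t} {.ab , l' , t'} refl =
    cong₂ (λ l t → ab , l , t) (<-irrelevant l l') (T-irrelevant t t')

  _≟ᴱ_ : DecidableEquality (Edge H)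
  e ≟ᴱ e' = map′ Edge-≡ (cong proj₁) (≡-dec _≟_ _≟_ (proj₁ e) (proj₁ e'))

  coincide-or-adjacent : ∀ {v w} e → v ∈ᵉ e → w ∈ᵉ e → v ≡ w ⊎ T (adj H v w)
  coincide-or-adjacent e (inj₁ p) (inj₁ q) = inj₁ (trans p (sym q))
  coincide-or-adjacent e (inj₂ p) (inj₂ q) = inj₁ (trans p (sym q))
  coincide-or-adjacent e (inj₁ refl) (inj₂ refl) = inj₂ (proj₂ (proj₂ e))
  coincide-or-adjacent e (inj₂ refl) (inj₁ refl) = inj₂ (subst T (adj-sym H (lo e) (hi e)) (proj₂ (proj₂ e)))

  spare : Fin 3
  spare = suc (suc zero)

  side : ∀ {v} e → v ∈ᵉ e → Fin 3
  side e (inj₁ _) = zero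
  side e (inj₂ _) = suc zero

  side≢spare : ∀ {v} e (i : v ∈ᵉ e) → side e i ≢ spare
  side≢spare e (inj₁ _) ()
  side≢spare e (inj₂ _) ()

  side-injective : ∀ {v w e e'} → e ≡ e' → (i : v ∈ᵉ e) (j : w ∈ᵉ e') →
                   side e i ≡ side e' j → v ≡ w
  side-injective refl (inj₁ p) (inj₁ q) _ = trans p (sym q)
  side-injective refl (inj₂ p) (inj₂ q) _ = trans p (sym q)
  side-injective refl (inj₁ p) (inj₂ q) ()
  side-injective refl (inj₂ p) (inj₁ q) ()

  dominatorSlot : ∀ e s → MAdj H (inj₂ e) s → Fin 3
  dominatorSlot e (inj₁ v) _ = zero
  dominatorSlot e (inj₂ f) (_ , v , _ , j) = side f j

  dominatorSlot≢spare : ∀ e s (a : MAdj H (inj₂ e) s) → dominatorSlot e s a ≢ spare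
  dominatorSlot≢spare e (inj₁ v) _ ()
  dominatorSlot≢spare e (inj₂ f) (_ , v , _ , j) = side≢spare f j

  dominatorSlot-endpoint : ∀ {e f v} s (a : MAdj H (inj₂ e) s) → s ≡ inj₂ f → (i : v ∈ᵉ f) →
                           side f i ≡ dominatorSlot e s a → v ∈ᵉ e × e ≢ f
  dominatorSlot-endpoint {e} {f} _ (e≢f , u , i , j) refl k eq =
    subst (_∈ᵉ e) (side-injective refl j k (sym eq)) i , e≢f

  dominatorSlot-common-endpoint : ∀ {e e'} s s' (a : MAdj H (inj₂ e) s) (a' : MAdj H (inj₂ e') s') →
                                  s ≡ s' → dominatorSlot e s a ≡ dominatorSlot e' s' a' →
                                  ∃ λ u → u ∈ᵉ e × u ∈ᵉ e'
  dominatorSlot-common-endpoint (inj₁ u) _ a a' refl _ = u , a , a'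
  dominatorSlot-common-endpoint (inj₂ f) _ (_ , u , i , j) a' refl eq =
    u , i , proj₁ (dominatorSlot-endpoint (inj₂ f) a' refl j eq)

  module _ (S : List (Fin m ⊎ Edge H)) (tds : IsTDS (Middle H) S) where

    pos : Fin m ⊎ Edge H → Fin (length S)
    pos x = index (tds x)

    dom : Fin m ⊎ Edge H → Fin m ⊎ Edge H
    dom x = lookup S (pos x)

    dom-adj : ∀ x → MAdj H x (dom x)
    dom-adj x = lookup-index (tds x)

    edge-dominator : ∀ {v} s → MAdj H (inj₁ v) s → Σ (Edge H) λ e → s ≡ inj₂ e × v ∈ᵉ e
    edge-dominator (inj₂ e) i = e , refl , i

    chosen : Fin m → Edge H
    chosen v = proj₁ (edge-dominator (dom (inj₁ v)) (dom-adj (inj₁ v)))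

    dom≡chosen : ∀ v → dom (inj₁ v) ≡ inj₂ (chosen v)
    dom≡chosen v = proj₁ (proj₂ (edge-dominator (dom (inj₁ v)) (dom-adj (inj₁ v))))

    ∈-chosen : ∀ v → v ∈ᵉ chosen v
    ∈-chosen v = proj₂ (proj₂ (edge-dominator (dom (inj₁ v)) (dom-adj (inj₁ v))))

    chosen-cong : ∀ {v w} → pos (inj₁ v) ≡ pos (inj₁ w) → chosen v ≡ chosen w
    chosen-cong {v} {w} eq =
      inj₂-injective (trans (sym (dom≡chosen v)) (trans (cong (lookup S) eq) (dom≡chosen w)))

    independent⇒≤length : ∀ {q} (ι : Fin q → Fin m) → Injective _≡_ _≡_ ι →
                          (∀ i j → ¬ T (adj H (ι i) (ι j))) → q ≤ length S
    independent⇒≤length ι ι-injective independent = injective⇒≤ pos∘ι-injective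
      where
      pos∘ι-injective : Injective _≡_ _≡_ (pos ∘ inj₁ ∘ ι)
      pos∘ι-injective {i} {j} eq
        with coincide-or-adjacent (chosen (ι i)) (∈-chosen (ι i))
               (subst (ι j ∈ᵉ_) (sym (chosen-cong eq)) (∈-chosen (ι j)))
      ... | inj₁ ιi≡ιj   = ι-injective ιi≡ιj
      ... | inj₂ adjacent = ⊥-elim (independent i j adjacent)

    data Role (v : Fin m) : Set where
      lower        : v ≡ lo (chosen v) → Role v
      upper-alone  : v ≡ hi (chosen v) → chosen (lo (chosen v)) ≢ chosen v → Role v
      upper-shared : v ≡ hi (chosen v) → chosen (lo (chosen v)) ≡ chosen v → Role v

    role : ∀ v → Role v
    role v with ∈-chosen v
    ... | inj₁ v≡lo = lower v≡lo
    ... | inj₂ v≡hi with chosen (lo (chosen v)) ≟ᴱ chosen v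
    ...   | yes shared = upper-shared v≡hi shared
    ...   | no alone   = upper-alone v≡hi alone

    shared⇒chosen-by-endpoints : ∀ {v} → v ≡ hi (chosen v) → chosen (lo (chosen v)) ≡ chosen v →
                                 ∀ {u} → u ∈ᵉ chosen v → chosen u ≡ chosen v
    shared⇒chosen-by-endpoints v≡hi shared (inj₁ u≡lo) = trans (cong chosen u≡lo) shared
    shared⇒chosen-by-endpoints v≡hi shared (inj₂ u≡hi) = cong chosen (trans u≡hi (sym v≡hi))

    lower⇒chosen-by-lo : ∀ {v w} → v ≡ lo (chosen v) → chosen v ≡ chosen w →
                         chosen (lo (chosen w)) ≡ chosen w
    lower⇒chosen-by-lo {v} {w} v≡lo same = begin
      chosen (lo (chosen w)) ≡⟨ cong (chosen ∘ lo) same ⟨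
      chosen (lo (chosen v)) ≡⟨ cong chosen v≡lo ⟨
      chosen v               ≡⟨ same ⟩
      chosen w               ∎
      where open ≡-Reasoning

    -- The charged slot of e is that of an endpoint u of e inside the dominator of e; it is free when
    -- both endpoints chose e, since then u did not choose the dominator.
    Slot : Set
    Slot = Fin (length S) × Fin 3

    firstSlot : Fin m → Slot
    firstSlot v = pos (inj₁ v) , side (chosen v) (∈-chosen v)

    chargedSlot : Edge H → Slot
    chargedSlot e = pos (inj₂ e) , dominatorSlot e (dom (inj₂ e)) (dom-adj (inj₂ e))

    chargedSlot≢spare : ∀ e → proj₂ (chargedSlot e) ≢ spare
    chargedSlot≢spare e = dominatorSlot≢spare e (dom (inj₂ e)) (dom-adj (inj₂ e))

    secondSlot : ∀ v → Role v → Slot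
    secondSlot v (lower _)          = pos (inj₁ v) , spare
    secondSlot v (upper-alone _ _)  = pos (inj₁ v) , spare
    secondSlot v (upper-shared _ _) = chargedSlot (chosen v)

    firstSlot-injective : ∀ {v w} → firstSlot v ≡ firstSlot w → v ≡ w
    firstSlot-injective eq =
      side-injective (chosen-cong (cong proj₁ eq)) (∈-chosen _) (∈-chosen _) (cong proj₂ eq)

    firstSlot≢secondSlot : ∀ v w (r : Role w) → firstSlot v ≢ secondSlot w r
    firstSlot≢secondSlot v w (lower _)         eq = side≢spare _ (∈-chosen v) (cong proj₂ eq)
    firstSlot≢secondSlot v w (upper-alone _ _) eq = side≢spare _ (∈-chosen v) (cong proj₂ eq)
    firstSlot≢secondSlot v w (upper-shared w≡hi shared) eq
      with dominatorSlot-endpoint (dom (inj₂ (chosen w))) (dom-adj (inj₂ (chosen w)))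
             (trans (sym (cong (lookup S) (cong proj₁ eq))) (dom≡chosen v)) (∈-chosen v) (cong proj₂ eq)
    ... | v∈e , e≢chosen-v = e≢chosen-v (sym (shared⇒chosen-by-endpoints w≡hi shared v∈e))

    secondSlot-injective : ∀ {v w} (r : Role v) (r' : Role w) → secondSlot v r ≡ secondSlot w r' → v ≡ w
    secondSlot-injective (lower v≡lo) (lower w≡lo) eq =
      trans v≡lo (trans (cong lo (chosen-cong (cong proj₁ eq))) (sym w≡lo))
    secondSlot-injective (upper-alone v≡hi _) (upper-alone w≡hi _) eq =
      trans v≡hi (trans (cong hi (chosen-cong (cong proj₁ eq))) (sym w≡hi))
    secondSlot-injective {v} {w} (upper-shared v≡hi shared) (upper-shared w≡hi shared') eq
      with dominatorSlot-common-endpoint _ _ (dom-adj _) (dom-adj _)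
             (cong (lookup S) (cong proj₁ eq)) (cong proj₂ eq)
    ... | u , u∈e , u∈e' = trans v≡hi (trans (cong hi same) (sym w≡hi))
      where
      same : chosen v ≡ chosen w
      same = trans (sym (shared⇒chosen-by-endpoints v≡hi shared u∈e))
                   (shared⇒chosen-by-endpoints w≡hi shared' u∈e')
    secondSlot-injective (lower v≡lo) (upper-alone _ alone) eq =
      ⊥-elim (alone (lower⇒chosen-by-lo v≡lo (chosen-cong (cong proj₁ eq))))
    secondSlot-injective (upper-alone _ alone) (lower w≡lo) eq =
      ⊥-elim (alone (lower⇒chosen-by-lo w≡lo (chosen-cong (sym (cong proj₁ eq)))))
    secondSlot-injective (lower _) (upper-shared _ _) eq =
      ⊥-elim (chargedSlot≢spare _ (sym (cong proj₂ eq)))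
    secondSlot-injective (upper-alone _ _) (upper-shared _ _) eq =
      ⊥-elim (chargedSlot≢spare _ (sym (cong proj₂ eq)))
    secondSlot-injective (upper-shared _ _) (lower _) eq =
      ⊥-elim (chargedSlot≢spare _ (cong proj₂ eq))
    secondSlot-injective (upper-shared _ _) (upper-alone _ _) eq =
      ⊥-elim (chargedSlot≢spare _ (cong proj₂ eq))

    slot : Fin m ⊎ Fin m → Slot
    slot (inj₁ v) = firstSlot v
    slot (inj₂ v) = secondSlot v (role v)

    slot-injective : Injective _≡_ _≡_ slot
    slot-injective {inj₁ v} {inj₁ w} eq = cong inj₁ (firstSlot-injective eq)
    slot-injective {inj₁ v} {inj₂ w} eq = ⊥-elim (firstSlot≢secondSlot v w (role w) eq)
    slot-injective {inj₂ v} {inj₁ w} eq = ⊥-elim (firstSlot≢secondSlot w v (role v) (sym eq))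
    slot-injective {inj₂ v} {inj₂ w} eq = cong inj₂ (secondSlot-injective (role v) (role w) eq)

    order+order≤length*3 : m + m ≤ length S * 3
    order+order≤length*3 = ⊎-to-×-injective⇒≤ slot slot-injective

m+m≤n*3⇒[2m+2]/3≤n : ∀ m n → m + m ≤ n * 3 → (2 * m + 2) / 3 ≤ n
m+m≤n*3⇒[2m+2]/3≤n m n m+m≤n*3 = ℕₚ.≤-pred (m<n*o⇒m/o<n (begin-strict
  2 * m + 2  ≡⟨ cong (λ t → m + t + 2) (ℕₚ.+-identityʳ m) ⟩
  m + m + 2  ≤⟨ ℕₚ.+-monoˡ-≤ 2 m+m≤n*3 ⟩
  n * 3 + 2  <⟨ ℕₚ.+-monoʳ-< (n * 3) (ℕₚ.n<1+n 2) ⟩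
  n * 3 + 3  ≡⟨ ℕₚ.+-comm (n * 3) 3 ⟩
  suc n * 3  ∎))
  where open ℕₚ.≤-Reasoning

-- A total dominating set of M(K_{n,p}) consisting of k edges; the edge between the v-th vertex of
-- one side and the w-th of the other is the pair (v , w).
record BicliqueTDS (n p k : ℕ) : Set where
  field
    edges  : List (Fin n × Fin p)
    unique : Unique edges
    size   : length edges ≡ k
    coverˡ : ∀ v → Any (λ e → proj₁ e ≡ v) edges
    coverʳ : ∀ w → Any (λ e → proj₂ e ≡ w) edges
    nextTo : ∀ v w → Any (λ e → e ≢ (v , w) × (proj₁ e ≡ v ⊎ proj₂ e ≡ w)) edges
open BicliqueTDS

private variable n p k : ℕ

transpose : BicliqueTDS n p k → BicliqueTDS p n k
transpose g = record
  { edges  = map swap (edges g)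
  ; unique = Uniqueₚ.map⁺ (cong swap) (unique g)
  ; size   = trans (length-map swap (edges g)) (size g)
  ; coverˡ = λ w → Anyₚ.map⁺ (coverʳ g w)
  ; coverʳ = λ v → Anyₚ.map⁺ (coverˡ g v)
  ; nextTo = λ w v → Anyₚ.map⁺ (Any.map (Product.map (_∘ cong swap) Sum.swap) (nextTo g v w))
  }

addCherryˡ : BicliqueTDS n p k → BicliqueTDS (2 + n) (1 + p) (2 + k)
addCherryˡ g = record
  { edges  = (zero , zero) ∷ (suc zero , zero) ∷ map shift (edges g)
  ; unique = ((λ ()) All.∷ Allₚ.map⁺ (All.universal (λ _ ()) _))
           ∷ Allₚ.map⁺ (All.universal (λ _ ()) _)
           ∷ Uniqueₚ.map⁺ shift-injective (unique g)
  ; size   = cong (2 +_) (trans (length-map shift (edges g)) (size g))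
  ; coverˡ = λ { zero          → here refl
               ; (suc zero)    → there (here refl)
               ; (suc (suc v)) → there (there (Anyₚ.map⁺ (Any.map (cong (Fin.suc ∘ Fin.suc)) (coverˡ g v)))) }
  ; coverʳ = λ { zero    → here refl
               ; (suc w) → there (there (Anyₚ.map⁺ (Any.map (cong Fin.suc) (coverʳ g w)))) }
  ; nextTo = nextTo′
  }
  where
  shift : Fin n × Fin p → Fin (2 + n) × Fin (1 + p)
  shift (v , w) = suc (suc v) , suc w
  shift-injective : Injective _≡_ _≡_ shift
  shift-injective eq = cong₂ _,_ (Finₚ.suc-injective (Finₚ.suc-injective (cong proj₁ eq)))
                                 (Finₚ.suc-injective (cong proj₂ eq))
  nextTo′ : ∀ v w → Any (λ e → e ≢ (v , w) × (proj₁ e ≡ v ⊎ proj₂ e ≡ w))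
                        ((zero , zero) ∷ (suc zero , zero) ∷ map shift (edges g))
  nextTo′ zero          zero    = there (here ((λ ()) , inj₂ refl))
  nextTo′ (suc zero)    zero    = here ((λ ()) , inj₂ refl)
  nextTo′ (suc (suc v)) zero    = here ((λ ()) , inj₂ refl)
  nextTo′ zero          (suc w) = here ((λ ()) , inj₁ refl)
  nextTo′ (suc zero)    (suc w) = there (here ((λ ()) , inj₁ refl))
  nextTo′ (suc (suc v)) (suc w) = there (there (Anyₚ.map⁺ (Any.map
    (Product.map (_∘ shift-injective) (Sum.map (cong (Fin.suc ∘ Fin.suc)) (cong Fin.suc))) (nextTo g v w))))

addLeafˡ : Fin p → BicliqueTDS n p k → BicliqueTDS (1 + n) p (1 + k)
addLeafˡ w₀ g = record
  { edges  = (zero , w₀) ∷ map shift (edges g)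
  ; unique = Allₚ.map⁺ (All.universal (λ _ ()) _) ∷ Uniqueₚ.map⁺ shift-injective (unique g)
  ; size   = cong suc (trans (length-map shift (edges g)) (size g))
  ; coverˡ = λ { zero    → here refl
               ; (suc v) → there (Anyₚ.map⁺ (Any.map (cong Fin.suc) (coverˡ g v))) }
  ; coverʳ = λ w → there (Anyₚ.map⁺ (coverʳ g w))
  ; nextTo = λ { zero    w → there (Anyₚ.map⁺ (Any.map (λ e≡w → (λ ()) , inj₂ e≡w) (coverʳ g w)))
               ; (suc v) w → there (Anyₚ.map⁺ (Any.map
                   (Product.map (_∘ shift-injective) (Sum.map₁ (cong Fin.suc))) (nextTo g v w))) }
  }
  where
  shift : Fin n × Fin p → Fin (1 + n) × Fin p
  shift (v , w) = suc v , w
  shift-injective : Injective _≡_ _≡_ shift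
  shift-injective eq = cong₂ _,_ (Finₚ.suc-injective (cong proj₁ eq)) (cong proj₂ eq)

addCherryʳ : BicliqueTDS n p k → BicliqueTDS (1 + n) (2 + p) (2 + k)
addCherryʳ = transpose ∘ addCherryˡ ∘ transpose

addLeafʳ : Fin n → BicliqueTDS n p k → BicliqueTDS n (1 + p) (1 + k)
addLeafʳ v₀ = transpose ∘ addLeafˡ v₀ ∘ transpose

castᴮ : ∀ {n' p' k'} → n ≡ n' → p ≡ p' → k ≡ k' → BicliqueTDS n p k → BicliqueTDS n' p' k'
castᴮ refl refl refl g = g

noEdges : BicliqueTDS 0 0 0
noEdges = record
  { edges = [] ; unique = [] ; size = refl ; coverˡ = λ () ; coverʳ = λ () ; nextTo = λ () }

someEdge : 1 ≤ k → BicliqueTDS n p k → Fin n × Fin p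
someEdge 1≤k g with edges g | size g
someEdge _   g | e ∷ _ | _    = e
someEdge ()  g | []    | refl

cherriesˡ : ∀ a → BicliqueTDS n p k → BicliqueTDS (a * 2 + n) (a + p) (a * 2 + k)
cherriesˡ zero    g = g
cherriesˡ (suc a) g = addCherryˡ (cherriesˡ a g)

cherriesʳ : ∀ b → BicliqueTDS n p k → BicliqueTDS (b + n) (b * 2 + p) (b * 2 + k)
cherriesʳ zero    g = g
cherriesʳ (suc b) g = addCherryʳ (cherriesʳ b g)

leavesˡ : ∀ c → Fin p → BicliqueTDS n p k → BicliqueTDS (c + n) p (c + k)
leavesˡ zero    w g = g
leavesˡ (suc c) w g = addLeafˡ w (leavesˡ c w g)

leavesʳ : ∀ d → Fin n → BicliqueTDS n p k → BicliqueTDS n (d + p) (d + k)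
leavesʳ zero    v g = g
leavesʳ (suc d) v g = addLeafʳ v (leavesʳ d v g)

starForest : ∀ a b c d → 1 ≤ a + b →
             a * 2 + b + c ≡ n → a + b * 2 + d ≡ p → (a + b) * 2 + c + d ≡ k →
             BicliqueTDS n p k
starForest a b c d 1≤a+b refl refl refl =
  castᴮ (order a b c) (order′ a b d) (size′ a b c d)
        (leavesˡ c (d ↑ʳ proj₂ edge) (leavesʳ d (proj₁ edge) cherries))
  where
  cherries : BicliqueTDS (a * 2 + (b + 0)) (a + (b * 2 + 0)) (a * 2 + (b * 2 + 0))
  cherries = cherriesˡ a (cherriesʳ b noEdges)
  twice : ∀ a b → (a + b) * 2 ≡ a * 2 + (b * 2 + 0)
  twice = solve-∀
  edge : Fin (a * 2 + (b + 0)) × Fin (a + (b * 2 + 0))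
  edge = someEdge (subst (1 ≤_) (twice a b) (ℕₚ.≤-trans 1≤a+b (ℕₚ.m≤m*n (a + b) 2))) cherries
  order : ∀ a b c → c + (a * 2 + (b + 0)) ≡ a * 2 + b + c
  order = solve-∀
  order′ : ∀ a b d → d + (a + (b * 2 + 0)) ≡ a + b * 2 + d
  order′ = solve-∀
  size′ : ∀ a b c d → c + (d + (a * 2 + (b * 2 + 0))) ≡ (a + b) * 2 + c + d
  size′ = solve-∀

biclique-tds-wide : 1 ≤ n → 2 * n ≤ p → BicliqueTDS n p p
biclique-tds-wide {n} 1≤n 2n≤p with ℕₚ.m≤n⇒∃[o]m+o≡n 2n≤p
... | d , refl = starForest 0 n 0 d 1≤n (ℕₚ.+-identityʳ n) (size′ n d) (size″ n d)
  where
  size′ : ∀ n d → 0 + n * 2 + d ≡ 2 * n + d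
  size′ = solve-∀
  size″ : ∀ n d → (0 + n) * 2 + 0 + d ≡ 2 * n + d
  size″ = solve-∀

biclique-tds-residue : ∀ s e₁ e₂ → 1 ≤ s → e₁ + s ≤ n → e₂ + s ≤ p →
                       n + p ≡ e₁ + e₂ + s * 3 →
                       BicliqueTDS n p (e₁ + e₂ + s * 2)
biclique-tds-residue {n} {p} s e₁ e₂ 1≤s e₁+s≤n e₂+s≤p n+p≡
  with ℕₚ.m≤n⇒∃[o]m+o≡n e₁+s≤n | ℕₚ.m≤n⇒∃[o]m+o≡n e₂+s≤p
... | α , refl | β , refl = starForest α β e₁ e₂ (subst (1 ≤_) (sym α+β≡s) 1≤s)
                              left right total
  where
  α+β≡s : α + β ≡ s
  α+β≡s = ℕₚ.+-cancelˡ-≡ (e₁ + e₂ + s * 2) _ _ (begin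
    e₁ + e₂ + s * 2 + (α + β)  ≡⟨ split e₁ e₂ s α β ⟩
    e₁ + s + α + (e₂ + s + β)  ≡⟨ n+p≡ ⟩
    e₁ + e₂ + s * 3            ≡⟨ join′ e₁ e₂ s ⟩
    e₁ + e₂ + s * 2 + s        ∎)
    where
    open ≡-Reasoning
    split : ∀ e₁ e₂ s α β → e₁ + e₂ + s * 2 + (α + β) ≡ e₁ + s + α + (e₂ + s + β)
    split = solve-∀
    join′ : ∀ e₁ e₂ s → e₁ + e₂ + s * 3 ≡ e₁ + e₂ + s * 2 + s
    join′ = solve-∀
  left-rearranged : ∀ α β e₁ → α * 2 + β + e₁ ≡ e₁ + (α + β) + α
  left-rearranged = solve-∀
  right-rearranged : ∀ α β e₂ → α + β * 2 + e₂ ≡ e₂ + (α + β) + β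
  right-rearranged = solve-∀
  total-rearranged : ∀ s e₁ e₂ → s * 2 + e₁ + e₂ ≡ e₁ + e₂ + s * 2
  total-rearranged = solve-∀
  left : α * 2 + β + e₁ ≡ e₁ + s + α
  left = trans (left-rearranged α β e₁) (cong (λ t → e₁ + t + α) α+β≡s)
  right : α + β * 2 + e₂ ≡ e₂ + s + β
  right = trans (right-rearranged α β e₂) (cong (λ t → e₂ + t + β) α+β≡s)
  total : (α + β) * 2 + e₁ + e₂ ≡ e₁ + e₂ + s * 2
  total = trans (cong (λ t → t * 2 + e₁ + e₂) α+β≡s) (total-rearranged s e₁ e₂)

two-thirds-ceiling : ∀ s (r : Fin 3) → (2 * (toℕ r + s * 3) + 2) / 3 ≡ toℕ r + s * 2
two-thirds-ceiling s r = begin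
  (2 * (toℕ r + s * 3) + 2) / 3        ≡⟨ /-congˡ (split (toℕ r) s) ⟩
  (2 * toℕ r + 2 + s * 2 * 3) / 3       ≡⟨ +-distrib-/-∣ʳ (2 * toℕ r + 2) (divides-refl (s * 2)) ⟩
  (2 * toℕ r + 2) / 3 + s * 2 * 3 / 3   ≡⟨ cong₂ _+_ (remainder r) (m*n/n≡m (s * 2) 3) ⟩
  toℕ r + s * 2                         ∎
  where
  open ≡-Reasoning
  split : ∀ r s → 2 * (r + s * 3) + 2 ≡ 2 * r + 2 + s * 2 * 3
  split = solve-∀
  remainder : ∀ r → (2 * toℕ r + 2) / 3 ≡ toℕ r
  remainder zero             = refl
  remainder (suc zero)       = refl
  remainder (suc (suc zero)) = refl

biclique-tds-balanced : 2 ≤ n → 1 ≤ p → n ≤ 2 * p → p < 2 * n → BicliqueTDS n p ((2 * (n + p) + 2) / 3)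
biclique-tds-balanced {n} {p} 2≤n 1≤p n≤2p p<2n with (n + p) divMod 3
... | result s r n+p≡ = castᴮ refl refl (sym size≡) (byResidue r n+p≡)
  where
  size≡ : (2 * (n + p) + 2) / 3 ≡ toℕ r + s * 2
  size≡ = trans (cong (λ t → (2 * t + 2) / 3) n+p≡) (two-thirds-ceiling s r)
  s*3≤n+p : s * 3 ≤ n + p
  s*3≤n+p = subst (s * 3 ≤_) (sym n+p≡) (ℕₚ.m≤n+m (s * 3) (toℕ r))
  n+p<n*3 : n + p < n * 3
  n+p<n*3 = subst (n + p <_) (thrice n) (ℕₚ.+-monoʳ-< n p<2n)
    where
    thrice : ∀ n → n + 2 * n ≡ n * 3
    thrice = solve-∀
  n+p≤p*3 : n + p ≤ p * 3
  n+p≤p*3 = subst (n + p ≤_) (thrice p) (ℕₚ.+-monoˡ-≤ p n≤2p)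
    where
    thrice : ∀ p → 2 * p + p ≡ p * 3
    thrice = solve-∀
  s<n : s < n
  s<n = ℕₚ.*-cancelʳ-< 3 s n (ℕₚ.≤-<-trans s*3≤n+p n+p<n*3)
  s≤p : s ≤ p
  s≤p = ℕₚ.*-cancelʳ-≤ s p 3 (ℕₚ.≤-trans s*3≤n+p n+p≤p*3)
  1≤s : 1 ≤ s
  1≤s = positive-quotient s (subst (3 ≤_) n+p≡ (ℕₚ.+-mono-≤ 2≤n 1≤p))
    where
    positive-quotient : ∀ s → 3 ≤ toℕ r + s * 3 → 1 ≤ s
    positive-quotient zero    3≤r =
      ⊥-elim (ℕₚ.<⇒≱ (Finₚ.toℕ<n r) (subst (3 ≤_) (ℕₚ.+-identityʳ (toℕ r)) 3≤r))
    positive-quotient (suc s) _   = s≤s z≤n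
  byResidue : ∀ r → n + p ≡ toℕ r + s * 3 → BicliqueTDS n p (toℕ r + s * 2)
  byResidue zero             eq = biclique-tds-residue s 0 0 1≤s (ℕₚ.<⇒≤ s<n) s≤p eq
  byResidue (suc zero)       eq = biclique-tds-residue s 1 0 1≤s s<n s≤p eq
  byResidue (suc (suc zero)) eq = biclique-tds-residue s 1 1 1≤s s<n s<p eq
    where
    s<p : s < p
    s<p = ℕₚ.*-cancelʳ-< 3 s p
            (ℕₚ.<-≤-trans (ℕₚ.m<n+m (s * 3) (s≤s z≤n)) (subst (_≤ p * 3) eq n+p≤p*3))

TDSOfSize : (H : Graph) → ℕ → Set
TDSOfSize H k = Σ (List (V H)) λ S → Unique S × IsTDS H S × length S ≡ k

module JoinWithEdgeless {n : ℕ} (G : SimpleGraph n) (p : ℕ) where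

  H : SimpleGraph (n + p)
  H = joinEmpty G p

  open MiddleGraphBounds H using (_∈ᵉ_; hi)

  data Part : Fin (n + p) → Set where
    left  : ∀ v → Part (v ↑ˡ p)
    right : ∀ w → Part (n ↑ʳ w)

  part : ∀ i → Part i
  part i with splitAt n i in eq
  ... | inj₁ v = subst Part (Finₚ.splitAt⁻¹-↑ˡ eq) (left v)
  ... | inj₂ w = subst Part (Finₚ.splitAt⁻¹-↑ʳ eq) (right w)

  left<right : ∀ (v : Fin n) (w : Fin p) → v ↑ˡ p Fin.< n ↑ʳ w
  left<right v w = subst₂ ℕ._<_ (sym (Finₚ.toℕ-↑ˡ v p)) (sym (Finₚ.toℕ-↑ʳ n w))
                     (ℕₚ.<-≤-trans (Finₚ.toℕ<n v) (ℕₚ.m≤m+n n (toℕ w)))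

  left-right-adjacent : ∀ (v : Fin n) (w : Fin p) → T (adj H (v ↑ˡ p) (n ↑ʳ w))
  left-right-adjacent v w =
    subst T (sym (cong₂ (joinAdj (adj G)) (Finₚ.splitAt-↑ˡ n v p) (Finₚ.splitAt-↑ʳ n p w))) _

  right-independent : ∀ (w w' : Fin p) → ¬ T (adj H (n ↑ʳ w) (n ↑ʳ w'))
  right-independent w w' = subst T (cong₂ (joinAdj (adj G)) (Finₚ.splitAt-↑ʳ n p w) (Finₚ.splitAt-↑ʳ n p w'))

  crossEdge : Fin n × Fin p → Edge H
  crossEdge (v , w) = (v ↑ˡ p , n ↑ʳ w) , left<right v w , left-right-adjacent v w

  crossEdge-endpoints-injective : ∀ {v w q} → (v ↑ˡ p , n ↑ʳ w) ≡ proj₁ (crossEdge q) → (v , w) ≡ q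
  crossEdge-endpoints-injective {v} {w} {v' , w'} eq =
    cong₂ _,_ (Finₚ.↑ˡ-injective p v v' (cong proj₁ eq)) (Finₚ.↑ʳ-injective n w w' (cong proj₂ eq))

  fromBiclique : ∀ {k} → BicliqueTDS n p k → TDSOfSize (Middle H) k
  fromBiclique g = map element (edges g) , Uniqueₚ.map⁺ element-injective (unique g) , tds
                 , trans (length-map element (edges g)) (size g)
    where
    element : Fin n × Fin p → Fin (n + p) ⊎ Edge H
    element = inj₂ ∘ crossEdge

    element-injective : Injective _≡_ _≡_ element
    element-injective eq = crossEdge-endpoints-injective (cong proj₁ (inj₂-injective eq))

    tds : IsTDS (Middle H) (map element (edges g))
    tds (inj₁ i) with part i
    ... | left v  = Anyₚ.map⁺ (Any.map (λ q≡v → inj₁ (cong (_↑ˡ p) (sym q≡v))) (coverˡ g v))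
    ... | right w = Anyₚ.map⁺ (Any.map (λ q≡w → inj₂ (cong (n ↑ʳ_) (sym q≡w))) (coverʳ g w))
    tds (inj₂ e@((a , b) , a<b , a~b)) with part a | part b
    ... | left v | left v' = Anyₚ.map⁺ (Any.map dominates (coverˡ g v))
      where
      dominates : ∀ {q} → proj₁ q ≡ v → MAdj H (inj₂ e) (element q)
      dominates q≡v = (λ e≡q → Finₚ.<⇒≢ (left<right v' _) (cong hi e≡q))
                    , v ↑ˡ p , inj₁ refl , inj₁ (cong (_↑ˡ p) (sym q≡v))
    ... | left v | right w = Anyₚ.map⁺ (Any.map dominates (nextTo g v w))
      where
      dominates : ∀ {q} → q ≢ (v , w) × (proj₁ q ≡ v ⊎ proj₂ q ≡ w) → MAdj H (inj₂ e) (element q)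
      dominates (q≢vw , shares) = (λ e≡q → q≢vw (sym (crossEdge-endpoints-injective (cong proj₁ e≡q))))
                                , common-endpoint shares
        where
        common-endpoint : ∀ {q} → proj₁ q ≡ v ⊎ proj₂ q ≡ w →
                          ∃ λ u → u ∈ᵉ e × u ∈ᵉ crossEdge q
        common-endpoint (inj₁ q≡v) = v ↑ˡ p , inj₁ refl , inj₁ (cong (_↑ˡ p) (sym q≡v))
        common-endpoint (inj₂ q≡w) = n ↑ʳ w , inj₂ refl , inj₂ (cong (n ↑ʳ_) (sym q≡w))
    ... | right w | left v   = ⊥-elim (Finₚ.<-asym a<b (left<right v w))
    ... | right w | right w' = ⊥-elim (right-independent w w' a~b)

theorem4p9 : (n : ℕ) (G : SimpleGraph n) → 2 ≤ n → Connected G →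
    (p : ℕ) → 1 ≤ p →
    (2 * n ≤ p → TotalDomNum (Middle (joinEmpty G p)) p) ×
    (n ≤ 2 * p → p < 2 * n →
      TotalDomNum (Middle (joinEmpty G p)) ((2 * (n + p) + 2) / 3))
theorem4p9 n G 2≤n _ p 1≤p = wide , balanced
  where
  open JoinWithEdgeless G p
  open MiddleGraphBounds H using (independent⇒≤length; order+order≤length*3)
  wide : 2 * n ≤ p → TotalDomNum (Middle H) p
  wide 2n≤p = fromBiclique (biclique-tds-wide (ℕₚ.≤-trans (s≤s z≤n) 2≤n) 2n≤p)
            , λ S _ tds → independent⇒≤length S tds (n ↑ʳ_) (Finₚ.↑ʳ-injective n _ _) right-independent
  balanced : n ≤ 2 * p → p < 2 * n → TotalDomNum (Middle H) ((2 * (n + p) + 2) / 3)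
  balanced n≤2p p<2n = fromBiclique (biclique-tds-balanced 2≤n 1≤p n≤2p p<2n)
                     , λ S _ tds → m+m≤n*3⇒[2m+2]/3≤n (n + p) (length S) (order+order≤length*3 S tds)
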